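{- Let $\varphi$ be a $\mathrm{C}^2$ sentence in normal form, $\mathcal{G}$ a finite $\sigma$-structure with $\mathcal{G}\models\varphi$, and $\mathcal{H}\subseteq\mathcal{G}$ an $\ell$-core of $\mathcal{G}$ with $\ell>2K^\varphi+1$. Then the 1-types realized in $\mathcal{G}\setminus\mathcal{H}$ are silent-compatible with respect to $\varphi$: for any 1-types $\pi_1,\pi_2$ (not necessarily distinct) each realized by some element of $\mathcal{G}\setminus\mathcal{H}$, $\pi_1$ and $\pi_2$ are silent-compatible.
   Context: Vocabulary $\sigma$: unary $U_1,\dots,U_n$, binary $R_1,\dots,R_m$. A $\mathrm{C}^2$ sentence in normal form is $\varphi=\forall x\,\gamma(x)\wedge\forall x\forall y\,(x\neq y\to\alpha(x,y))\wedge\bigwedge_{i=1}^{m'}\forall x\,\exists^{=k_i}y\,(R_i(x,y)\wedge x\neq y)$ with $\gamma,\alpha$ quantifier-free, $0\le m'\le m$, $k_i\in\mathbb{N}$; $K^\varphi:=\sum_i k_i$. 1-types: maximal consistent subsets of $\{U_i(x),\neg U_i(x)\}_{i\le n}\cup\{R_i(x,x),\neg R_i(x,x)\}_{i\le m}$; 2-types: maximal consistent subsets of $\{R_i(x,y),\neg R_i(x,y),R_i(y,x),\neg R_i(y,x)\}_{i\le m}$; $\bar\eta$ swaps $x,y$. $\mathsf{TwoTps}^\varphi_{\pi_1,\pi_2}$ is the set of 2-types $\eta$ with $\pi_1(x)\wedge\eta(x,y)\wedge\pi_2(y)\models\alpha(x,y)$ and $\pi_2(x)\wedge\bar\eta(x,y)\wedge\pi_1(y)\models\alpha(x,y)$.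 $\eta$ is forward-silent if $\neg R_i(x,y)\in\eta$ for all $i\le m'$, backward-silent if $\neg R_i(y,x)\in\eta$ for all $i\le m'$. $\pi_1,\pi_2$ are silent-compatible if some $\eta\in\mathsf{TwoTps}^\varphi_{\pi_1,\pi_2}$ is both forward- and backward-silent. For a substructure $\mathcal{H}$ of $\mathcal{G}$, $\mathcal{G}\setminus\mathcal{H}$ denotes the elements not in $\mathcal{H}$. $\mathcal{H}$ is an $\ell$-core of $\mathcal{G}$ if (i) for every 1-type $\pi$ the number of elements of $\mathcal{G}\setminus\mathcal{H}$ with 1-type $\pi$ is $0$ or at least $\ell$, and (ii) for all 1-types $\pi_1,\pi_2$ and 2-types $\eta$, the number of pairs of distinct elements $v,u$ of $\mathcal{G}\setminus\mathcal{H}$ with 1-types $\pi_1,\pi_2$ and 2-type $\mathrm{TwoTp}(v,u)=\eta$ is $0$ or at least $\ell$. -}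

module Defs where

open import Data.Nat using (ℕ; zero; suc; _+_; _≤_)
open import Data.Bool using (Bool; true; false; not; _∧_; _∨_; if_then_else_)
open import Data.Fin using (Fin; zero; suc; inject≤)
import Data.Fin as Fin
open import Data.Vec using (Vec; tabulate; lookup; map)
open import Data.Vec.Properties using (≡-dec)
open import Data.Product using (_×_; _,_; proj₁; proj₂; Σ; ∃)
import Data.Product as Prod
import Data.Product.Properties as ProdP
open import Data.Sum using (_⊎_)
import Data.Bool as B
open import Relation.Nullary.Decidable using (⌊_⌋)
open import Relation.Binary.PropositionalEquality using (_≡_)

data Var : Set where
  vx vy : Var

data QF (n m : ℕ) : Set where
  U    : Fin n → Var → QF n m
  R    : Fin m → Var → Var → QF n m
  Eq   : Var → Var → QF n m
  tt   : QF n m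
  neg  : QF n m → QF n m
  _and_ : QF n m → QF n m → QF n m
  _or_  : QF n m → QF n m → QF n m

record Structure (n m : ℕ) : Set where
  field
    size : ℕ
    Uᴳ   : Fin n → Fin size → Bool
    Rᴳ   : Fin m → Fin size → Fin size → Bool
open Structure public

eval : ∀ {n m} (G : Structure n m) → QF n m → (Var → Fin (size G)) → Bool
eval G (U i v)     ρ = Uᴳ G i (ρ v)
eval G (R i v w)   ρ = Rᴳ G i (ρ v) (ρ w)
eval G (Eq v w)    ρ = ⌊ ρ v Fin.≟ ρ w ⌋
eval G tt          ρ = true
eval G (neg φ)     ρ = not (eval G φ ρ)
eval G (φ and ψ)   ρ = eval G φ ρ ∧ eval G ψ ρ
eval G (φ or ψ)    ρ = eval G φ ρ ∨ eval G ψ ρ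

asg : ∀ {N} → Fin N → Fin N → Var → Fin N
asg a b vx = a
asg a b vy = b

count : ∀ {N} → (Fin N → Bool) → ℕ
count {zero}  f = 0
count {suc N} f = (if f zero then 1 else 0) + count (λ i → f (suc i))

sumFin : ∀ {k} → (Fin k → ℕ) → ℕ
sumFin {zero}  f = 0
sumFin {suc k} f = f zero + sumFin (λ i → f (suc i))

count2 : ∀ {N} → (Fin N → Fin N → Bool) → ℕ
count2 f = sumFin (λ v → count (f v))

distinct : ∀ {N} → Fin N → Fin N → Bool
distinct a b = not ⌊ a Fin.≟ b ⌋

-- C² sentences in normal form:
--  ∀x γ(x) ∧ ∀x∀y (x≠y → α(x,y)) ∧ ⋀_{i<m'} ∀x ∃^{=k_i} y (R_i(x,y) ∧ x≠y)
-- The counting conjuncts use the first m' binary symbols.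

record NormalForm (n m : ℕ) : Set where
  field
    γ    : QF n m      -- only the variable x is meant; evaluated with y := x
    α    : QF n m
    m'   : ℕ
    m'≤m : m' ≤ m
    k    : Fin m' → ℕ
open NormalForm public


K : ∀ {n m} → NormalForm n m → ℕ
K φ = sumFin (k φ)

cnt : ∀ {n m} (φ : NormalForm n m) → Fin (m' φ) → Fin m
cnt φ i = inject≤ i (m'≤m φ)

_⊨_ : ∀ {n m} → Structure n m → NormalForm n m → Set
G ⊨ φ =
  (∀ a → eval G (γ φ) (asg a a) ≡ true)
  × (∀ a b → ¬≡ a b → eval G (α φ) (asg a b) ≡ true)
  × (∀ i a → count (λ b → Rᴳ G (cnt φ i) a b ∧ distinct a b) ≡ k φ i)
  where
  ¬≡ : Fin (size G) → Fin (size G) → Set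
  ¬≡ a b = distinct a b ≡ true

-- A 1-type is a maximal consistent set of literals over U_i(x), R_i(x,x):
-- it is given by the truth values of U_i(x) and R_i(x,x).
-- A 2-type is a maximal consistent set of literals over R_i(x,y), R_i(y,x):
-- for each i, the pair (truth of R_i(x,y), truth of R_i(y,x)).

record OneType (n m : ℕ) : Set where
  constructor ⟨_,_⟩
  field
    uni  : Vec Bool n
    loop : Vec Bool m
open OneType public

TwoType : ℕ → Set
TwoType m = Vec (Bool × Bool) m

swapη : ∀ {m} → TwoType m → TwoType m
swapη = map Prod.swap

oneTypeEq : ∀ {n m} → OneType n m → OneType n m → Bool
oneTypeEq ⟨ u , l ⟩ ⟨ u' , l' ⟩ = ⌊ ≡-dec B._≟_ u u' ⌋ ∧ ⌊ ≡-dec B._≟_ l l' ⌋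

pairEq : Bool × Bool → Bool × Bool → Bool
pairEq (a , b) (c , d) = ⌊ a B.≟ c ⌋ ∧ ⌊ b B.≟ d ⌋

twoTypeEq : ∀ {m} → TwoType m → TwoType m → Bool
twoTypeEq η η' = ⌊ ≡-dec (λ p q → ProdP.≡-dec B._≟_ B._≟_ p q) η η' ⌋

OneTp : ∀ {n m} (G : Structure n m) → Fin (size G) → OneType n m
OneTp G a = ⟨ tabulate (λ i → Uᴳ G i a) , tabulate (λ i → Rᴳ G i a a) ⟩

TwoTp : ∀ {n m} (G : Structure n m) → Fin (size G) → Fin (size G) → TwoType m
TwoTp G a b = tabulate (λ i → Rᴳ G i a b , Rᴳ G i b a)

-- truth value of a QF atom/formula in the (unique up to iso) two-element
-- configuration x ≠ y with 1-types π₁(x), π₂(y) and 2-type η(x,y).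
evalT : ∀ {n m} → QF n m → OneType n m → TwoType m → OneType n m → Bool
evalT (U i vx)     π₁ η π₂ = lookup (uni π₁) i
evalT (U i vy)     π₁ η π₂ = lookup (uni π₂) i
evalT (R i vx vx)  π₁ η π₂ = lookup (loop π₁) i
evalT (R i vy vy)  π₁ η π₂ = lookup (loop π₂) i
evalT (R i vx vy)  π₁ η π₂ = proj₁ (lookup η i)
evalT (R i vy vx)  π₁ η π₂ = proj₂ (lookup η i)
evalT (Eq vx vx)   π₁ η π₂ = true
evalT (Eq vy vy)   π₁ η π₂ = true
evalT (Eq vx vy)   π₁ η π₂ = false
evalT (Eq vy vx)   π₁ η π₂ = false
evalT tt           π₁ η π₂ = true
evalT (neg φ)      π₁ η π₂ = not (evalT φ π₁ η π₂)
evalT (φ and ψ)    π₁ η π₂ = evalT φ π₁ η π₂ ∧ evalT ψ π₁ η π₂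
evalT (φ or ψ)     π₁ η π₂ = evalT φ π₁ η π₂ ∨ evalT ψ π₁ η π₂

Entails : ∀ {n m} → OneType n m → TwoType m → OneType n m → QF n m → Set
Entails π₁ η π₂ α = evalT α π₁ η π₂ ≡ true

InTwoTps : ∀ {n m} (φ : NormalForm n m) → OneType n m → OneType n m → TwoType m → Set
InTwoTps φ π₁ π₂ η = Entails π₁ η π₂ (α φ) × Entails π₂ (swapη η) π₁ (α φ)

ForwardSilent : ∀ {n m} (φ : NormalForm n m) → TwoType m → Set
ForwardSilent φ η = ∀ (i : Fin (m' φ)) → proj₁ (lookup η (cnt φ i)) ≡ false

BackwardSilent : ∀ {n m} (φ : NormalForm n m) → TwoType m → Set
BackwardSilent φ η = ∀ (i : Fin (m' φ)) → proj₂ (lookup η (cnt φ i)) ≡ false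

SilentCompatible : ∀ {n m} (φ : NormalForm n m) → OneType n m → OneType n m → Set
SilentCompatible φ π₁ π₂ =
  Σ (TwoType _) λ η → InTwoTps φ π₁ π₂ η × ForwardSilent φ η × BackwardSilent φ η

-- Substructures are induced, hence determined by their domain, given as
-- a Boolean membership predicate H : Fin (size G) → Bool.

Sub : ∀ {n m} → Structure n m → Set
Sub G = Fin (size G) → Bool

outside : ∀ {n m} (G : Structure n m) → Sub G → Fin (size G) → Bool
outside G H a = not (H a)

ZeroOrAtLeast : ℕ → ℕ → Set
ZeroOrAtLeast ℓ c = c ≡ 0 ⊎ ℓ ≤ c

IsCore : ∀ {n m} (G : Structure n m) → Sub G → ℕ → Set
IsCore G H ℓ =
  (∀ (π : OneType _ _) →
     ZeroOrAtLeast ℓ (count (λ a → outside G H a ∧ oneTypeEq (OneTp G a) π)))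
  × (∀ (π₁ π₂ : OneType _ _) (η : TwoType _) →
     ZeroOrAtLeast ℓ (count2 (λ v u →
        outside G H v ∧ outside G H u ∧ distinct v u
        ∧ oneTypeEq (OneTp G v) π₁ ∧ oneTypeEq (OneTp G u) π₂
        ∧ twoTypeEq (TwoTp G v u) η)))

RealizedOutside : ∀ {n m} (G : Structure n m) → Sub G → OneType n m → Set
RealizedOutside G H π = Σ (Fin (size G)) λ a → (H a ≡ false) × (OneTp G a ≡ π)

{-# OPTIONS --safe #-}
-- Let P and Q be the elements outside H of 1-types π₁ and π₂; by the core condition each has at
-- least ℓ ≥ 2K+2 elements. Every element has at most K counting successors, so among the |P|·|Q|
-- pairs (v, u) at most K|P| have a counting edge v → u, at most K|Q| one u → v, and at most |P|
-- have v = u. Since |P|, |Q| ≥ 2K+2 some pair is left over; its 2-type is silent in both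
-- directions and, as G ⊨ φ, lies in TwoTps^φ_{π₁,π₂}. Only condition (i) of an ℓ-core is needed.
module Submission where

open import Defs
open import Data.Nat using (ℕ; _+_; _*_; _<_; zero; suc; _≤_; z≤n; s≤s)
open import Data.Nat.Properties hiding (_≟_)
open import Data.Nat.Tactic.RingSolver using (solve-∀)
open import Data.Bool using (Bool; true; false; not; _∧_; _∨_; if_then_else_)
open import Data.Bool.Properties using (∧-conicalˡ; ∧-conicalʳ; ∨-conicalˡ; ∨-conicalʳ; ∧-identityʳ)
import Data.Bool as B
open import Data.Fin using (Fin; zero; suc; _≟_)
open import Data.Vec.Properties using (lookup∘tabulate; tabulate-∘; ≡-dec)
open import Data.Product using (_×_; _,_; proj₁; proj₂; ∃; ∃₂; swap)
import Data.Product as Σ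
open import Data.Sum using (inj₁; inj₂)
open import Function using (_∘_; id)
open import Relation.Nullary using (¬_; Dec; yes; no; does; contradiction)
open import Relation.Nullary.Decidable using (⌊_⌋; isYes≗does; dec-true; dec-false)
open import Relation.Binary.PropositionalEquality
open import Algebra.Properties.CommutativeMonoid.Sum +-0-commutativeMonoid
  using (sum; sum-cong-≗; ∑-distrib-+; ∑-comm)

does≡false⇒¬ : ∀ {a} {A : Set a} (a? : Dec A) → does a? ≡ false → ¬ A
does≡false⇒¬ (no ¬a) _ = ¬a
does≡false⇒¬ (yes _) ()

⌊⌋≡true⇒ : ∀ {a} {A : Set a} (a? : Dec A) → ⌊ a? ⌋ ≡ true → A
⌊⌋≡true⇒ (yes a) _ = a
⌊⌋≡true⇒ (no _) ()

⌊⌋-true : ∀ {a} {A : Set a} (a? : Dec A) → A → ⌊ a? ⌋ ≡ true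
⌊⌋-true a? a = trans (isYes≗does a?) (dec-true a? a)

⌊⌋-false : ∀ {a} {A : Set a} (a? : Dec A) → ¬ A → ⌊ a? ⌋ ≡ false
⌊⌋-false a? ¬a = trans (isYes≗does a?) (dec-false a? ¬a)

sumFin≡sum : ∀ {N} (f : Fin N → ℕ) → sumFin f ≡ sum f
sumFin≡sum {zero}  f = refl
sumFin≡sum {suc N} f = cong (f zero +_) (sumFin≡sum (f ∘ suc))

count≡sum : ∀ {N} (f : Fin N → Bool) → count f ≡ sum (λ a → if f a then 1 else 0)
count≡sum {zero}  f = refl
count≡sum {suc N} f = cong ((if f zero then 1 else 0) +_) (count≡sum (f ∘ suc))

sumFin-mono : ∀ {N} {f g : Fin N → ℕ} → (∀ i → f i ≤ g i) → sumFin f ≤ sumFin g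
sumFin-mono {zero}  f≤g = z≤n
sumFin-mono {suc N} {f} {g} f≤g = +-mono-≤ (f≤g zero) (sumFin-mono {f = f ∘ suc} {g ∘ suc} (f≤g ∘ suc))

sumFin-+ : ∀ {N} (f g : Fin N → ℕ) → sumFin (λ i → f i + g i) ≡ sumFin f + sumFin g
sumFin-+ f g = begin
  sumFin (λ i → f i + g i) ≡⟨ sumFin≡sum (λ i → f i + g i) ⟩
  sum (λ i → f i + g i)    ≡⟨ ∑-distrib-+ f g ⟩
  sum f + sum g            ≡⟨ cong₂ _+_ (sumFin≡sum f) (sumFin≡sum g) ⟨
  sumFin f + sumFin g      ∎
  where open ≡-Reasoning

sumFin-<⇒∃ : ∀ {N} (f g : Fin N → ℕ) → sumFin f < sumFin g → ∃ λ i → f i < g i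
sumFin-<⇒∃ {suc N} f g Σf<Σg with f zero <? g zero | sumFin (f ∘ suc) <? sumFin (g ∘ suc)
... | yes f₀<g₀ | _        = zero , f₀<g₀
... | no _      | yes rest = let i , fi<gi = sumFin-<⇒∃ (f ∘ suc) (g ∘ suc) rest in suc i , fi<gi
... | no f₀≮g₀  | no rest  = contradiction Σf<Σg (≤⇒≯ (+-mono-≤ (≮⇒≥ f₀≮g₀) (≮⇒≥ rest)))

count-false : ∀ N → count {N} (λ _ → false) ≡ 0
count-false zero    = refl
count-false (suc N) = count-false N

count-positive : ∀ {N} (f : Fin N → Bool) {a} → f a ≡ true → 0 < count f
count-positive f {zero}  fa≡true rewrite fa≡true = s≤s z≤n
count-positive f {suc a} fa≡true = ≤-trans (count-positive (f ∘ suc) fa≡true) (m≤n+m _ _)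

-- Stated with does: ⌊_⌋ = isYes does not compute through the map′ in Fin's _≟_.
count-≟ : ∀ {N} (v : Fin N) → count (λ u → does (v ≟ u)) ≡ 1
count-≟ {suc N} zero    = cong suc (count-false N)
count-≟         (suc v) = count-≟ v

count-∨ : ∀ {N} (f g : Fin N → Bool) → count (λ a → f a ∨ g a) ≤ count f + count g
count-∨ {zero}  f g = z≤n
count-∨ {suc N} f g with f zero | g zero | count-∨ (f ∘ suc) (g ∘ suc)
... | true  | b     | ih = s≤s (≤-trans ih (+-monoʳ-≤ _ (m≤n+m (count (g ∘ suc)) (if b then 1 else 0))))
... | false | true  | ih = ≤-trans (s≤s ih) (≤-reflexive (sym (+-suc _ _)))
... | false | false | ih = ih

count-<⇒∃ : ∀ {N} (f g : Fin N → Bool) → count f < count g → ∃ λ a → g a ≡ true × f a ≡ false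
count-<⇒∃ {suc N} f g cf<cg with g zero in g₀ | f zero in f₀
... | true  | false = zero , g₀ , f₀
... | true  | true  = Σ.map suc id (count-<⇒∃ (f ∘ suc) (g ∘ suc) (+-cancelˡ-< 1 _ _ cf<cg))
... | false | _     = Σ.map suc id (count-<⇒∃ (f ∘ suc) (g ∘ suc) (≤-<-trans (m≤n+m _ _) cf<cg))

sumFin-count-transpose : ∀ {A B} (f : Fin A → Fin B → Bool) →
  sumFin (λ v → count (f v)) ≡ sumFin (λ u → count (λ v → f v u))
sumFin-count-transpose f = begin
  sumFin (λ v → count (f v))                       ≡⟨ sumFin≡sum (λ v → count (f v)) ⟩
  sum (λ v → count (f v))                          ≡⟨ sum-cong-≗ (count≡sum ∘ f) ⟩
  sum (λ v → sum (λ u → if f v u then 1 else 0))   ≡⟨ ∑-comm (λ v u → if f v u then 1 else 0) ⟩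
  sum (λ u → sum (λ v → if f v u then 1 else 0))   ≡⟨ sum-cong-≗ (λ u → count≡sum (λ v → f v u)) ⟨
  sum (λ u → count (λ v → f v u))                  ≡⟨ sumFin≡sum (λ u → count (λ v → f v u)) ⟨
  sumFin (λ u → count (λ v → f v u))               ∎
  where open ≡-Reasoning

sumFin-count-∧-≤ : ∀ {A B} (P : Fin A → Bool) (f : Fin A → Fin B → Bool) {c} →
  (∀ v → count (f v) ≤ c) → sumFin (λ v → count (λ u → P v ∧ f v u)) ≤ count P * c
sumFin-count-∧-≤ {zero}      P f rows≤c = z≤n
sumFin-count-∧-≤ {suc A} {B} P f rows≤c with P zero
... | true  = +-mono-≤ (rows≤c zero) (sumFin-count-∧-≤ (P ∘ suc) (f ∘ suc) (rows≤c ∘ suc))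
... | false rewrite count-false B = sumFin-count-∧-≤ (P ∘ suc) (f ∘ suc) (rows≤c ∘ suc)

sumFin-count-∧-* : ∀ {A B} (P : Fin A → Bool) (Q : Fin B → Bool) →
  sumFin (λ v → count (λ u → P v ∧ Q u)) ≡ count P * count Q
sumFin-count-∧-* {zero}      P Q = refl
sumFin-count-∧-* {suc A} {B} P Q with P zero
... | true  = cong (count Q +_) (sumFin-count-∧-* (P ∘ suc) Q)
... | false rewrite count-false B = sumFin-count-∧-* (P ∘ suc) Q

count2-∨ : ∀ {N} (f g : Fin N → Fin N → Bool) →
  count2 (λ v u → f v u ∨ g v u) ≤ count2 f + count2 g
count2-∨ f g = ≤-trans (sumFin-mono (λ v → count-∨ (f v) (g v)))
                       (≤-reflexive (sumFin-+ (λ v → count (f v)) (λ v → count (g v))))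

count2-<⇒∃ : ∀ {N} (f g : Fin N → Fin N → Bool) → count2 f < count2 g →
  ∃₂ λ v u → g v u ≡ true × f v u ≡ false
count2-<⇒∃ f g Σf<Σg =
  let v , fv<gv = sumFin-<⇒∃ (λ v → count (f v)) (λ v → count (g v)) Σf<Σg
  in  v , count-<⇒∃ (f v) (g v) fv<gv

-- With p = 2K+2+a and q = 2K+2+b the difference is 2K+2 + (K+1)a + (K+2)b + ab.
*-beats-linear : ∀ K {p q} → 2 * K + 1 < p → 2 * K + 1 < q → p * K + q * K + p < p * q
*-beats-linear K 2K+1<p 2K+1<q with m≤n⇒∃[o]m+o≡n 2K+1<p | m≤n⇒∃[o]m+o≡n 2K+1<q
... | a , refl | b , refl = ≤-trans (m≤m+n _ _) (≤-reflexive (expand K a b))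
  where
  expand : ∀ K a b → let p = suc (2 * K + 1) + a ; q = suc (2 * K + 1) + b in
    suc (p * K + q * K + p) + (2 * K + 1 + (K + 1) * a + (K + 2) * b + a * b) ≡ p * q
  expand = solve-∀

∃-non-adjacent-pair : ∀ {N} (E : Fin N → Fin N → Bool) (P Q : Fin N → Bool) K →
  (∀ v → count (E v) ≤ K) → 2 * K + 1 < count P → 2 * K + 1 < count Q →
  ∃₂ λ v u → P v ≡ true × Q u ≡ true × v ≢ u × E v u ≡ false × E u v ≡ false
∃-non-adjacent-pair {N} E P Q K deg≤K P-large Q-large =
  let v , u , PvQu , ¬bad = count2-<⇒∃ bad (λ v u → P v ∧ Q u) few-bad-pairs
      Pv = ∧-conicalˡ (P v) (Q u) PvQu
      Qu = ∧-conicalʳ (P v) (Q u) PvQu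
  in  v , u , Pv , Qu , good Pv Qu ¬bad
  where
  forward backward diagonal bad : Fin N → Fin N → Bool
  forward  v u = P v ∧ E v u
  backward v u = Q u ∧ E u v
  diagonal v u = P v ∧ does (v ≟ u)
  bad      v u = forward v u ∨ backward v u ∨ diagonal v u

  p q : ℕ
  p = count P
  q = count Q

  few-bad-pairs : count2 bad < count2 (λ v u → P v ∧ Q u)
  few-bad-pairs = begin-strict
    count2 bad
      ≤⟨ count2-∨ forward (λ v u → backward v u ∨ diagonal v u) ⟩
    count2 forward + count2 (λ v u → backward v u ∨ diagonal v u)
      ≤⟨ +-monoʳ-≤ (count2 forward) (count2-∨ backward diagonal) ⟩
    count2 forward + (count2 backward + count2 diagonal)
      ≤⟨ +-mono-≤ (sumFin-count-∧-≤ P E deg≤K)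
                  (+-mono-≤ (≤-trans (≤-reflexive (sumFin-count-transpose backward))
                                     (sumFin-count-∧-≤ Q E deg≤K))
                            (sumFin-count-∧-≤ P (λ v u → does (v ≟ u)) (≤-reflexive ∘ count-≟))) ⟩
    p * K + (q * K + p * 1)
      ≡⟨ trans (sym (+-assoc (p * K) _ _)) (cong (p * K + q * K +_) (*-identityʳ p)) ⟩
    p * K + q * K + p
      <⟨ *-beats-linear K P-large Q-large ⟩
    p * q
      ≡⟨ sumFin-count-∧-* P Q ⟨
    count2 (λ v u → P v ∧ Q u) ∎
    where open ≤-Reasoning

  good : ∀ {v u} → P v ≡ true → Q u ≡ true → bad v u ≡ false →
    v ≢ u × E v u ≡ false × E u v ≡ false
  good {v} {u} Pv Qu ¬bad =
    does≡false⇒¬ (v ≟ u) (subst (λ b → b ∧ does (v ≟ u) ≡ false) Pv ¬diagonal) ,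
    subst (λ b → b ∧ E v u ≡ false) Pv ¬forward ,
    subst (λ b → b ∧ E u v ≡ false) Qu ¬backward
    where
    ¬forward : forward v u ≡ false
    ¬forward = ∨-conicalˡ (forward v u) (backward v u ∨ diagonal v u) ¬bad
    ¬rest : backward v u ∨ diagonal v u ≡ false
    ¬rest = ∨-conicalʳ (forward v u) (backward v u ∨ diagonal v u) ¬bad
    ¬backward : backward v u ≡ false
    ¬backward = ∨-conicalˡ (backward v u) (diagonal v u) ¬rest
    ¬diagonal : diagonal v u ≡ false
    ¬diagonal = ∨-conicalʳ (backward v u) (diagonal v u) ¬rest

anyFin : ∀ {k} → (Fin k → Bool) → Bool
anyFin {zero}  f = false
anyFin {suc k} f = f zero ∨ anyFin (f ∘ suc)

anyFin≡false : ∀ {k} (f : Fin k → Bool) → anyFin f ≡ false → ∀ i → f i ≡ false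
anyFin≡false f none zero    = ∨-conicalˡ (f zero) (anyFin (f ∘ suc)) none
anyFin≡false f none (suc i) = anyFin≡false (f ∘ suc) (∨-conicalʳ (f zero) (anyFin (f ∘ suc)) none) i

count-anyFin : ∀ {k N} (f : Fin k → Fin N → Bool) →
  count (λ b → anyFin (λ i → f i b)) ≤ sumFin (λ i → count (f i))
count-anyFin {zero}  {N} f = ≤-reflexive (count-false N)
count-anyFin {suc k}     f = ≤-trans (count-∨ (f zero) (λ b → anyFin (λ i → f (suc i) b)))
                                     (+-monoʳ-≤ (count (f zero)) (count-anyFin (f ∘ suc)))

≢⇒distinct : ∀ {N} {a b : Fin N} → a ≢ b → distinct a b ≡ true
≢⇒distinct {a = a} {b} a≢b = cong not (⌊⌋-false (a ≟ b) a≢b)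

module _ {n m : ℕ} where

  oneTypeEq-refl : (π : OneType n m) → oneTypeEq π π ≡ true
  oneTypeEq-refl ⟨ u , l ⟩ = cong₂ _∧_ (⌊⌋-true (≡-dec B._≟_ u u) refl) (⌊⌋-true (≡-dec B._≟_ l l) refl)

  oneTypeEq⇒≡ : {π π′ : OneType n m} → oneTypeEq π π′ ≡ true → π ≡ π′
  oneTypeEq⇒≡ {⟨ u , l ⟩} {⟨ u′ , l′ ⟩} eq =
    cong₂ ⟨_,_⟩ (⌊⌋≡true⇒ (≡-dec B._≟_ u u′) (∧-conicalˡ _ _ eq))
                (⌊⌋≡true⇒ (≡-dec B._≟_ l l′) (∧-conicalʳ _ _ eq))

  eval-asg : (G : Structure n m) (ψ : QF n m) {a b : Fin (size G)} → a ≢ b →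
    eval G ψ (asg a b) ≡ evalT ψ (OneTp G a) (TwoTp G a b) (OneTp G b)
  eval-asg G (U i vx)    a≢b = sym (lookup∘tabulate _ i)
  eval-asg G (U i vy)    a≢b = sym (lookup∘tabulate _ i)
  eval-asg G (R i vx vx) a≢b = sym (lookup∘tabulate _ i)
  eval-asg G (R i vy vy) a≢b = sym (lookup∘tabulate _ i)
  eval-asg G (R i vx vy) a≢b = sym (cong proj₁ (lookup∘tabulate _ i))
  eval-asg G (R i vy vx) a≢b = sym (cong proj₂ (lookup∘tabulate _ i))
  eval-asg G (Eq vx vx) {a}     a≢b = ⌊⌋-true (a ≟ a) refl
  eval-asg G (Eq vy vy) {b = b} a≢b = ⌊⌋-true (b ≟ b) refl
  eval-asg G (Eq vx vy) {a} {b} a≢b = ⌊⌋-false (a ≟ b) a≢b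
  eval-asg G (Eq vy vx) {a} {b} a≢b = ⌊⌋-false (b ≟ a) (≢-sym a≢b)
  eval-asg G tt          a≢b = refl
  eval-asg G (neg ψ)     a≢b = cong not (eval-asg G ψ a≢b)
  eval-asg G (ψ and χ)   a≢b = cong₂ _∧_ (eval-asg G ψ a≢b) (eval-asg G χ a≢b)
  eval-asg G (ψ or χ)    a≢b = cong₂ _∨_ (eval-asg G ψ a≢b) (eval-asg G χ a≢b)

  swapη-TwoTp : (G : Structure n m) (a b : Fin (size G)) → swapη (TwoTp G a b) ≡ TwoTp G b a
  swapη-TwoTp G a b = sym (tabulate-∘ swap _)

  TwoTp∈TwoTps : (φ : NormalForm n m) (G : Structure n m) → G ⊨ φ → {a b : Fin (size G)} → a ≢ b →
    InTwoTps φ (OneTp G a) (OneTp G b) (TwoTp G a b)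
  TwoTp∈TwoTps φ G (_ , α-holds , _) {a} {b} a≢b =
    α-entailed a≢b ,
    subst (λ η → Entails (OneTp G b) η (OneTp G a) (α φ)) (sym (swapη-TwoTp G a b))
          (α-entailed (≢-sym a≢b))
    where
    α-entailed : ∀ {x y} → x ≢ y → Entails (OneTp G x) (TwoTp G x y) (OneTp G y) (α φ)
    α-entailed {x} {y} x≢y = trans (sym (eval-asg G (α φ) x≢y)) (α-holds x y (≢⇒distinct x≢y))

  countingEdge : (φ : NormalForm n m) (G : Structure n m) → Fin (size G) → Fin (size G) → Bool
  countingEdge φ G a b = anyFin (λ i → Rᴳ G (cnt φ i) a b ∧ distinct a b)

  countingEdge-outdegree : (φ : NormalForm n m) (G : Structure n m) → G ⊨ φ →
    ∀ a → count (countingEdge φ G a) ≤ K φ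
  countingEdge-outdegree φ G (_ , _ , k-exact) a =
    ≤-trans (count-anyFin (λ i b → Rᴳ G (cnt φ i) a b ∧ distinct a b))
            (sumFin-mono (λ i → ≤-reflexive (k-exact i a)))

  ¬countingEdge⇒¬R : (φ : NormalForm n m) (G : Structure n m) {a b : Fin (size G)} → a ≢ b →
    countingEdge φ G a b ≡ false → ∀ i → Rᴳ G (cnt φ i) a b ≡ false
  ¬countingEdge⇒¬R φ G {a} {b} a≢b none i =
    trans (sym (∧-identityʳ _))
          (subst (λ d → Rᴳ G (cnt φ i) a b ∧ d ≡ false) (≢⇒distinct a≢b) (anyFin≡false _ none i))

  ¬countingEdge⇒forwardSilent : (φ : NormalForm n m) (G : Structure n m) {a b : Fin (size G)} → a ≢ b →
    countingEdge φ G a b ≡ false → ForwardSilent φ (TwoTp G a b)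
  ¬countingEdge⇒forwardSilent φ G a≢b none i =
    trans (cong proj₁ (lookup∘tabulate _ (cnt φ i))) (¬countingEdge⇒¬R φ G a≢b none i)

  ¬countingEdge⇒backwardSilent : (φ : NormalForm n m) (G : Structure n m) {a b : Fin (size G)} → a ≢ b →
    countingEdge φ G b a ≡ false → BackwardSilent φ (TwoTp G a b)
  ¬countingEdge⇒backwardSilent φ G a≢b none i =
    trans (cong proj₂ (lookup∘tabulate _ (cnt φ i))) (¬countingEdge⇒¬R φ G (≢-sym a≢b) none i)

  outsideOfType : (G : Structure n m) → Sub G → OneType n m → Fin (size G) → Bool
  outsideOfType G H π a = outside G H a ∧ oneTypeEq (OneTp G a) π

  outsideOfType⇒OneTp : (G : Structure n m) (H : Sub G) {π : OneType n m} {a : Fin (size G)} →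
    outsideOfType G H π a ≡ true → OneTp G a ≡ π
  outsideOfType⇒OneTp G H {π} {a} eq = oneTypeEq⇒≡ (∧-conicalʳ (outside G H a) _ eq)

  realized⇒ℓ≤count : (G : Structure n m) (H : Sub G) {ℓ : ℕ} {π : OneType n m} →
    IsCore G H ℓ → RealizedOutside G H π → ℓ ≤ count (outsideOfType G H π)
  realized⇒ℓ≤count G H (none-or-many , _) (a , a∉H , refl) with none-or-many (OneTp G a)
  ... | inj₂ many = many
  ... | inj₁ none =
    contradiction (subst (0 <_) none (count-positive (outsideOfType G H (OneTp G a)) a-outside)) n≮0
    where
    a-outside : outsideOfType G H (OneTp G a) a ≡ true
    a-outside = cong₂ _∧_ (cong not a∉H) (oneTypeEq-refl (OneTp G a))

lemma34 : ∀ {n m : ℕ} (φ : NormalForm n m) (G : Structure n m) → G ⊨ φ →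
          (H : Sub G) (ℓ : ℕ) → IsCore G H ℓ → 2 * K φ + 1 < ℓ →
          ∀ (π₁ π₂ : OneType n m) →
          RealizedOutside G H π₁ → RealizedOutside G H π₂ →
          SilentCompatible φ π₁ π₂
lemma34 φ G G⊨φ H ℓ core 2K+1<ℓ π₁ π₂ π₁-realized π₂-realized =
  let v , u , v:π₁ , u:π₂ , v≢u , ¬v→u , ¬u→v =
        ∃-non-adjacent-pair (countingEdge φ G) (outsideOfType G H π₁) (outsideOfType G H π₂) (K φ)
          (countingEdge-outdegree φ G G⊨φ)
          (<-≤-trans 2K+1<ℓ (realized⇒ℓ≤count G H core π₁-realized))
          (<-≤-trans 2K+1<ℓ (realized⇒ℓ≤count G H core π₂-realized))
  in  TwoTp G v u
    , subst₂ (λ π π′ → InTwoTps φ π π′ (TwoTp G v u))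
             (outsideOfType⇒OneTp G H v:π₁) (outsideOfType⇒OneTp G H u:π₂) (TwoTp∈TwoTps φ G G⊨φ v≢u)
    , ¬countingEdge⇒forwardSilent φ G v≢u ¬v→u
    , ¬countingEdge⇒backwardSilent φ G v≢u ¬u→v
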